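{- Let $\omega$ be a permutation, $\alpha$ a reduced word of $\omega$, $T_\alpha$ the standard tower tableau of $\alpha$ and $D_\alpha$ the canonical labelling of the Rothe diagram $D_\omega$ associated to $\alpha$. Then $T_\alpha$ is obtained from $D_\alpha$ by pushing all labels up to the corresponding columns and rearranging them in increasing order from bottom to top; that is, for every $c$, the labels in the tower of $T_\alpha$ with index $c$, read from bottom to top, are exactly the labels of $D_\alpha$ in column $c$ of $D_\omega$, arranged in increasing order.
   Context: Permutations are written in one-line notation $\omega=\omega_1\cdots\omega_n$; $s_a=(a,a+1)$ and $\omega s_a$ swaps the entries in positions $a,a+1$; a reduced word of $\omega$ is a word $\alpha_1\cdots\alpha_l$ with $\omega=s_{\alpha_1}\cdots s_{\alpha_l}$, $l$ the number of inversions of $\omega$. A tower diagram is a finite sequence $(\mathcal T_1,\mathcal T_2,\ldots)$ of towers; the $i$-th tower of size $k_i\ge0$ consists of the cells $(i,0),\ldots,(i,k_i-1)$, the cell $(i,j)$ being the unit square $[i-1,i]\times[j,j+1]$ identified with its south-east corner, lying on the diagonal $x+y=i+j$; $i$ is its tower index. Sliding. For a positive integer $a$ and a tail $(\mathcal T_p,\ldots)$ of a tower diagram, $a^{\searrow}(\mathcal T_p,\ldots)$ either adds one cell or terminates: (S1) if no tower $\mathcal T_t$, $t\ge p$, has a cell on $x+y=a-1$: (a) if none has a cell on $x+y=a$, add $(a,0)$; (b) if $(a,0)\in\mathcal T_a$, $(a,1)\notin\mathcal T_a$, terminate; (c) if $(a,0),(a,1)\in\mathcal T_a$, result is $(a+1)^{\searrow}(\mathcal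 T_{a+1},\ldots)$. (S2) Otherwise, with $\mathcal T_i$ ($i\ge p$) the leftmost tower having a cell $(i,a-1-i)$: (a) if $(i,a-i)\notin\mathcal T_i$, add it; (b) if $(i,a-i)\in\mathcal T_i$, $(i,a-i+1)\notin\mathcal T_i$, terminate; (c) if both are in $\mathcal T_i$, result is $(a+1)^{\searrow}(\mathcal T_{i+1},\ldots)$. Sliding $a$ into $\mathcal T$ is $a^{\searrow}(\mathcal T_1,\ldots)$. The standard tower tableau $T_\alpha$ of a reduced word $\alpha$ is obtained by sliding its letters one by one into the empty diagram and labelling the cell created by the $k$-th letter with $k$. Rothe diagram: $D_\omega=\{(i,\omega_j): i<j,\ \omega_i>\omega_j\}$, $(r,c)$ meaning row $r$, column $c$. Canonical labelling: for a reduced word $\alpha=\alpha_1\cdots\alpha_l$ of $\omega$, form $w^{(0)}=\mathrm{id}$, $w^{(r)}=w^{(r-1)}s_{\alpha_r}$ (so $w^{(l)}=\omega$); step $r$ swaps two values. $D_\alpha$ labels the cell $(i,j)\in D_\omega$ (where $j<\omega_i$) by the unique $r$ such that step $r$ swaps the values $\omega_i$ and $j$. -}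

module Defs where

open import Data.Nat using (ℕ; zero; suc; _+_; _∸_; _≤_; _<_; _≤?_; _<?_; _≟_)
open import Data.Nat.ListAction using (sum)
open import Data.List using (List; []; _∷_; length; map; filter; upTo; _++_; [_])
open import Data.List.Relation.Unary.Any using (any?)
open import Data.List.Relation.Unary.All using (All)
open import Data.List.Relation.Binary.Permutation.Propositional using (_↭_)
open import Data.Maybe using (Maybe; just; nothing)
open import Data.Product using (_×_; _,_; Σ)
open import Data.Sum using (_⊎_)
open import Data.Bool using (Bool; true; false; if_then_else_; _∧_; _∨_)
open import Relation.Nullary using (does)
open import Relation.Nullary.Decidable using (_×-dec_)
open import Relation.Binary.PropositionalEquality using (_≡_)

-- the p-th entry (p ≥ 1) of a list; 0 if out of range
nth : ℕ → List ℕ → ℕ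
nth _ [] = 0
nth zero (x ∷ xs) = 0
nth (suc zero) (x ∷ xs) = x
nth (suc (suc p)) (x ∷ xs) = nth (suc p) xs

from : ℕ → ℕ → List ℕ
from p len = map (p +_) (upTo len)

oneTo : ℕ → List ℕ
oneTo n = from 1 n

IsPermutation : List ℕ → Set
IsPermutation ω = ω ↭ oneTo (length ω)

-- ω s_a : swap the entries in positions a, a+1 (a ≥ 1)
swapAt : ℕ → List ℕ → List ℕ
swapAt zero xs = xs
swapAt (suc zero) (x ∷ y ∷ r) = y ∷ x ∷ r
swapAt (suc zero) xs = xs
swapAt (suc (suc a)) [] = []
swapAt (suc (suc a)) (x ∷ r) = x ∷ swapAt (suc a) r

applyWord : List ℕ → List ℕ → List ℕ
applyWord w [] = w
applyWord w (a ∷ as) = applyWord (swapAt a w) as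

inversions : List ℕ → ℕ
inversions [] = 0
inversions (x ∷ xs) = length (filter (λ y → y <? x) xs) + inversions xs

IsReducedWord : List ℕ → List ℕ → Set
IsReducedWord ω α =
  All (λ a → 1 ≤ a × a < length ω) α
  × applyWord (oneTo (length ω)) α ≡ ω
  × length α ≡ inversions ω

-- A tower tableau: the t-th element (t ≥ 1) is the list of labels of
-- tower T_t read from bottom to top; towers beyond the list are empty.
TowerTableau : Set
TowerTableau = List (List ℕ)

tower : ℕ → TowerTableau → List ℕ
tower _ [] = []
tower zero (x ∷ xs) = []
tower (suc zero) (x ∷ xs) = x
tower (suc (suc c)) (x ∷ xs) = tower (suc c) xs

sizes : TowerTableau → List ℕ
sizes = map length

-- does tower t (sizes ks) contain a cell on the diagonal x+y = d,
-- i.e. the cell (t, d - t) with t ≤ d and d - t < k_t ?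
onDiag : List ℕ → ℕ → ℕ → Bool
onDiag ks d t = does (t ≤? d) ∧ does ((d ∸ t) <? nth t ks)

leftmost : (ℕ → Bool) → List ℕ → Maybe ℕ
leftmost P [] = nothing
leftmost P (t ∷ ts) = if P t then just t else leftmost P ts

filterB : (ℕ → Bool) → List ℕ → List ℕ
filterB P [] = []
filterB P (t ∷ ts) = if P t then t ∷ filterB P ts else filterB P ts

anyB : (ℕ → Bool) → List ℕ → Bool
anyB P [] = false
anyB P (t ∷ ts) = P t ∨ anyB P ts

-- slideF fuel a p ks  computes  a↘(T_p, ...)  for a diagram with tower
-- sizes ks.  Result: just t  = one cell is added on top of tower T_t;
-- nothing = the sliding terminates (no cell added).
-- Case S1 / S2 as in the paper; the fuel only guarantees termination
-- of the definition (see `slide` below for a sufficient amount).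
slideF : ℕ → ℕ → ℕ → List ℕ → Maybe ℕ
slideF zero a p ks = nothing
slideF (suc f) a p ks with leftmost (onDiag ks (a ∸ 1)) (from p (a ∸ p))
-- (S1): no tower T_t, p ≤ t (≤ a-1), has a cell on x+y = a-1
... | nothing =
  if anyB (onDiag ks a) (from p (suc a ∸ p))
  then (if does (nth a ks ≟ 1) then nothing
        else if does (2 ≤? nth a ks)
             then slideF f (suc a) (suc a) ks
             else nothing)
  else just a                                           -- (S1a): add (a,0)
-- (S2): T_i the leftmost tower (i ≥ p) having the cell (i, a-1-i)
... | just i =
  if does ((a ∸ i) <? nth i ks)
  then (if does ((suc (a ∸ i)) <? nth i ks)
        then slideF f (suc a) (suc i) ks
        else nothing)
  else just i                                           -- (S2a): add (i, a-i)

slide : ℕ → List ℕ → Maybe ℕ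
slide a ks = slideF (suc (suc (a + length ks + sum ks))) a 1 ks

pushOn : ℕ → ℕ → TowerTableau → TowerTableau
pushOn zero k T = T
pushOn (suc zero) k [] = [ k ] ∷ []
pushOn (suc zero) k (x ∷ xs) = (x ++ [ k ]) ∷ xs
pushOn (suc (suc t)) k [] = [] ∷ pushOn (suc t) k []
pushOn (suc (suc t)) k (x ∷ xs) = x ∷ pushOn (suc t) k xs

buildTableau : ℕ → List ℕ → TowerTableau → Maybe TowerTableau
buildTableau k [] T = just T
buildTableau k (a ∷ as) T with slide a (sizes T)
... | nothing = nothing
... | just t = buildTableau (suc k) as (pushOn t k T)

standardTowerTableau : List ℕ → Maybe TowerTableau
standardTowerTableau α = buildTableau 1 α []

inRothe : List ℕ → ℕ → ℕ → Bool
inRothe ω i c =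
  anyB (λ j → does (i <? j) ∧ does (nth j ω ≟ c) ∧ does (c <? nth i ω))
       (oneTo (length ω))

rotheColumn : List ℕ → ℕ → List ℕ
rotheColumn ω c = filterB (λ i → inRothe ω i c) (oneTo (length ω))

swaps : ℕ → List ℕ → List ℕ → List (ℕ × ℕ × ℕ)
swaps r w [] = []
swaps r w (a ∷ as) = (r , nth a w , nth (suc a) w) ∷ swaps (suc r) (swapAt a w) as

swapsValues : ℕ → ℕ → ℕ × ℕ × ℕ → Bool
swapsValues u v (_ , x , y) =
  (does (x ≟ u) ∧ does (y ≟ v)) ∨ (does (x ≟ v) ∧ does (y ≟ u))

-- the (unique, for reduced words) step r swapping u and v; 0 if none
stepSwapping : List (ℕ × ℕ × ℕ) → ℕ → ℕ → ℕ
stepSwapping [] u v = 0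
stepSwapping ((r , x , y) ∷ ss) u v =
  if swapsValues u v (r , x , y) then r else stepSwapping ss u v

-- label of the cell (i, c) ∈ D_ω in D_α : the step swapping ω_i and c
canonicalLabel : List ℕ → List ℕ → ℕ → ℕ → ℕ
canonicalLabel ω α i c = stepSwapping (swaps 1 (oneTo (length ω)) α) (nth i ω) c

columnLabels : List ℕ → List ℕ → ℕ → List ℕ
columnLabels ω α c = map (λ i → canonicalLabel ω α i c) (rotheColumn ω c)

-- Build T_α and the canonical labelling D_α side by side. After the first k letters, with
-- w = s_{α_1} ⋯ s_{α_k}, tower c of the partial tableau holds, in increasing order, the labels of
-- column c of the Rothe diagram of w, whose cells are the entries of w larger than c standing
-- before c. As α is reduced, the next letter a swaps an ascent x < y of w at positions a, a + 1:
-- this adds to column x the cell of y, with the new, largest label k + 1, and only reorders the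
-- other columns. Counting entries of w on either side of position a shows that sliding a into
-- the tableau passes the towers t < x with t before position a, is lifted by one diagonal at the
-- towers t < x with t after position a + 1, and comes to rest on top of tower x.

module Submission where

open import Defs
open import Data.Bool using (Bool; true; false; if_then_else_; _∧_; _∨_)
open import Data.Bool.Properties using (∧-identityʳ; ∧-zeroʳ; ∧-comm; ∧-distribʳ-∨; ∨-zeroʳ)
open import Data.Empty using (⊥-elim)
open import Data.List using (List; []; _∷_; length; map; filter; upTo; applyUpTo; _++_; [_])
open import Data.List.Properties
  using (map-upTo; map-∘; map-cong; map-cong-local; map-++; length-map; length-upTo; length-++;
         ++-identityʳ; ++-assoc; filter-++; filter-none; filter-accept; filter-reject)
open import Data.List.Membership.Propositional using (_∈_; _∉_)
open import Data.List.Membership.Propositional.Properties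
  using (∈-map⁺; ∈-map⁻; ∈-upTo⁺; ∈-upTo⁻; ∈-++⁺ˡ; ∈-++⁺ʳ; ∈-++⁻; ∈-filter⁻)
open import Data.List.Relation.Unary.All using (All; []; _∷_)
import Data.List.Relation.Unary.All as All
open import Data.List.Relation.Unary.All.Properties using (¬Any⇒All¬; ++⁻ˡ; ++⁻ʳ)
open import Data.List.Relation.Unary.Any using (here; there)
open import Data.List.Relation.Unary.AllPairs using (AllPairs; []; _∷_)
open import Data.List.Relation.Unary.Linked using (Linked)
open import Data.List.Relation.Unary.Linked.Properties using (AllPairs⇒Linked)
open import Data.List.Relation.Unary.Unique.Propositional using (Unique)
open import Data.List.Relation.Unary.Unique.Propositional.Properties
  using (Unique[x∷xs]⇒x∉xs) renaming (map⁺ to Unique-map⁺; upTo⁺ to Unique-upTo⁺)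
open import Data.List.Relation.Binary.Permutation.Propositional
  using (_↭_; ↭⇒↭ₛ; ↭-refl; ↭-sym; ↭-trans; ↭-swap; ↭-reflexive; module PermutationReasoning)
open import Data.List.Relation.Binary.Permutation.Propositional.Properties
  using (↭-length; filter-↭; ∈-resp-↭; ++⁺ˡ; ++⁺ʳ; map⁺)
open import Data.List.Relation.Binary.Permutation.Setoid.Properties using (Unique-resp-↭)
open import Data.Nat
open import Data.Nat.Properties
open import Data.Nat.ListAction using (sum)
open import Data.Nat.Tactic.RingSolver using (solve-∀)
open import Algebra.Properties.CommutativeSemigroup +-commutativeSemigroup using (x∙yz≈y∙xz)
open import Data.List.Membership.DecPropositional Data.Nat._≟_ using (_∈?_)
open import Data.Maybe using (Maybe; just; nothing)
open import Data.Product using (Σ; ∃; _×_; _,_; proj₁; proj₂)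
open import Data.Sum using (inj₁; inj₂)
open import Function using (_∘_; case_of_)
open import Relation.Nullary using (Dec; does; yes; no; ¬_)
open import Relation.Nullary.Decidable using (dec-true; dec-false)
open import Relation.Binary.Definitions using (tri<; tri≈; tri>)
open import Relation.Binary.PropositionalEquality hiding ([_])

from-suc : ∀ p n → from p (suc n) ≡ p ∷ from (suc p) n
from-suc p n = cong₂ _∷_ (+-identityʳ p) (begin
  map (p +_) (applyUpTo suc n)   ≡⟨ cong (map (p +_)) (sym (map-upTo suc n)) ⟩
  map (p +_) (map suc (upTo n))  ≡⟨ sym (map-∘ (upTo n)) ⟩
  map (λ i → p + suc i) (upTo n) ≡⟨ map-cong (+-suc p) (upTo n) ⟩
  map (suc p +_) (upTo n)        ∎)
  where open ≡-Reasoning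

∈-from⁻ : ∀ {v} p n → v ∈ from p n → p ≤ v × v < p + n
∈-from⁻ p n v∈ with ∈-map⁻ (p +_) v∈
... | i , i∈ , refl = m≤m+n p i , +-monoʳ-< p (∈-upTo⁻ i∈)

∈-from⁺ : ∀ {v} p n → p ≤ v → v < p + n → v ∈ from p n
∈-from⁺ p n p≤v v<p+n with m≤n⇒∃[o]m+o≡n p≤v
... | o , refl = ∈-map⁺ (p +_) (∈-upTo⁺ (+-cancelˡ-< p o n v<p+n))

length-oneTo : ∀ n → length (oneTo n) ≡ n
length-oneTo n = trans (length-map (1 +_) (upTo n)) (length-upTo n)

Unique-from : ∀ p n → Unique (from p n)
Unique-from p n = Unique-map⁺ (+-cancelˡ-≡ p _ _) (Unique-upTo⁺ n)

Unique-↭ : ∀ {xs ys : List ℕ} → xs ↭ ys → Unique xs → Unique ys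
Unique-↭ xs↭ys = Unique-resp-↭ (setoid ℕ) (↭⇒↭ₛ xs↭ys)

Unique-++⁻ : ∀ (xs : List ℕ) {ys} → Unique (xs ++ ys) →
  Unique xs × Unique ys × (∀ {v} → v ∈ xs → v ∉ ys)
Unique-++⁻ [] u = [] , u , λ ()
Unique-++⁻ (x ∷ xs) (x≢ ∷ u) with Unique-++⁻ xs u
... | uxs , uys , disjoint = ++⁻ˡ xs x≢ ∷ uxs , uys , λ
  { (here refl) v∈ys → All.lookup (++⁻ʳ xs x≢) v∈ys refl
  ; (there v∈xs) → disjoint v∈xs }

upTo-suc : ∀ m → upTo (suc m) ≡ 0 ∷ map suc (upTo m)
upTo-suc m = cong (0 ∷_) (sym (map-upTo suc m))

map-nth-upTo : ∀ vs → map (λ q → nth (suc q) vs) (upTo (length vs)) ≡ vs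
map-nth-upTo [] = refl
map-nth-upTo (v ∷ vs) = begin
  map (λ q → nth (suc q) (v ∷ vs)) (upTo (suc m))         ≡⟨ cong (map _) (upTo-suc m) ⟩
  v ∷ map (λ q → nth (suc q) (v ∷ vs)) (map suc (upTo m)) ≡⟨ cong (v ∷_) (sym (map-∘ (upTo m))) ⟩
  v ∷ map (λ q → nth (suc q) vs) (upTo m)                 ≡⟨ cong (v ∷_) (map-nth-upTo vs) ⟩
  v ∷ vs                                                  ∎
  where
  open ≡-Reasoning
  m = length vs

nth-middle : ∀ (P : List ℕ) x y Q → nth (suc (length P)) (P ++ x ∷ y ∷ Q) ≡ x
nth-middle [] x y Q = refl
nth-middle (z ∷ P) x y Q = nth-middle P x y Q

nth-middle′ : ∀ (P : List ℕ) x y Q → nth (suc (suc (length P))) (P ++ x ∷ y ∷ Q) ≡ y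
nth-middle′ [] x y Q = refl
nth-middle′ (z ∷ P) x y Q = nth-middle′ P x y Q

swapAt-middle : ∀ (P : List ℕ) x y Q → swapAt (suc (length P)) (P ++ x ∷ y ∷ Q) ≡ P ++ y ∷ x ∷ Q
swapAt-middle [] x y Q = refl
swapAt-middle (z ∷ P) x y Q = cong (z ∷_) (swapAt-middle P x y Q)

adjacentAt : ∀ a (w : List ℕ) → 1 ≤ a → a < length w →
  ∃ λ P → ∃ λ x → ∃ λ y → ∃ λ Q → w ≡ P ++ x ∷ y ∷ Q × suc (length P) ≡ a
adjacentAt (suc zero) (x ∷ y ∷ Q) _ _ = [] , x , y , Q , refl , refl
adjacentAt (suc zero) (x ∷ []) _ (s≤s ())
adjacentAt (suc (suc a)) (z ∷ w) _ (s≤s a<|w|) with adjacentAt (suc a) w (s≤s z≤n) a<|w|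
... | P , x , y , Q , refl , refl = z ∷ P , x , y , Q , refl , refl

↭-swap-middle : ∀ (P : List ℕ) x y Q → P ++ y ∷ x ∷ Q ↭ P ++ x ∷ y ∷ Q
↭-swap-middle P x y Q = ++⁺ˡ P (↭-swap y x ↭-refl)

nth≢0⇒≤length : ∀ t (ks : List ℕ) → 0 < nth t ks → t ≤ length ks
nth≢0⇒≤length zero ks _ = z≤n
nth≢0⇒≤length (suc zero) (k ∷ ks) _ = s≤s z≤n
nth≢0⇒≤length (suc (suc t)) (k ∷ ks) 0<k = s≤s (nth≢0⇒≤length (suc t) ks 0<k)

count< count> count≡ : ℕ → List ℕ → ℕ
count< t xs = length (filter (_<? t) xs)
count> t xs = length (filter (t <?_) xs)
count≡ t xs = length (filter (t ≟_) xs)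

count<-++ : ∀ t (xs ys : List ℕ) → count< t (xs ++ ys) ≡ count< t xs + count< t ys
count<-++ t xs ys = trans (cong length (filter-++ (_<? t) xs ys)) (length-++ (filter (_<? t) xs))

count<-↭ : ∀ t {xs ys : List ℕ} → xs ↭ ys → count< t xs ≡ count< t ys
count<-↭ t xs↭ys = ↭-length (filter-↭ (_<? t) xs↭ys)

count<-from : ∀ t p n → t ≤ p + n → count< t (from p n) ≡ t ∸ p
count<-from t p zero t≤p+0 = sym (m≤n⇒m∸n≡0 (subst (t ≤_) (+-identityʳ p) t≤p+0))
count<-from t p (suc n) t≤p+1+n with p <? t
... | yes p<t = begin
  count< t (from p (suc n))       ≡⟨ cong (count< t) (from-suc p n) ⟩
  count< t (p ∷ from (suc p) n)   ≡⟨ cong length (filter-accept (_<? t) p<t) ⟩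
  suc (count< t (from (suc p) n)) ≡⟨ cong suc (count<-from t (suc p) n (subst (t ≤_) (+-suc p n) t≤p+1+n)) ⟩
  suc (t ∸ suc p)                 ≡⟨ sym (+-∸-assoc 1 p<t) ⟩
  t ∸ p                           ∎
  where open ≡-Reasoning
... | no p≮t = begin
  count< t (from p (suc n))       ≡⟨ cong (count< t) (from-suc p n) ⟩
  count< t (p ∷ from (suc p) n)   ≡⟨ cong length (filter-reject (_<? t) p≮t) ⟩
  count< t (from (suc p) n)       ≡⟨ count<-from t (suc p) n (subst (t ≤_) (+-suc p n) t≤p+1+n) ⟩
  t ∸ suc p                       ≡⟨ m≤n⇒m∸n≡0 (m≤n⇒m≤1+n (≮⇒≥ p≮t)) ⟩
  0                               ≡⟨ sym (m≤n⇒m∸n≡0 (≮⇒≥ p≮t)) ⟩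
  t ∸ p                           ∎
  where open ≡-Reasoning

count-trichotomy : ∀ t (xs : List ℕ) → count< t xs + count> t xs + count≡ t xs ≡ length xs
count-trichotomy t [] = refl
count-trichotomy t (v ∷ xs) with <-cmp v t
... | tri< v<t v≢t v≯t
  rewrite dec-true (v <? t) v<t | dec-false (t <? v) v≯t | dec-false (t ≟ v) (v≢t ∘ sym) =
  cong suc (count-trichotomy t xs)
... | tri≈ v≮t refl v≯t
  rewrite dec-false (v <? v) v≮t | dec-true (v ≟ v) refl =
  trans (+-suc _ _) (cong suc (count-trichotomy v xs))
... | tri> v≮t v≢t v>t
  rewrite dec-false (v <? t) v≮t | dec-true (t <? v) v>t | dec-false (t ≟ v) (v≢t ∘ sym) =
  trans (cong (_+ count≡ t xs) (+-suc _ _)) (cong suc (count-trichotomy t xs))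

count≡-∉ : ∀ {t} (xs : List ℕ) → t ∉ xs → count≡ t xs ≡ 0
count≡-∉ {t} xs t∉xs = cong length (filter-none (t ≟_) (¬Any⇒All¬ xs t∉xs))

count≡-∈ : ∀ {t} {xs : List ℕ} → Unique xs → t ∈ xs → count≡ t xs ≡ 1
count≡-∈ {t} {_ ∷ xs} (t∉ ∷ _) (here refl) =
  trans (cong length (filter-accept (t ≟_) refl))
        (cong suc (count≡-∉ xs (λ t∈ → All.lookup t∉ t∈ refl)))
count≡-∈ {t} {v ∷ _} (v∉ ∷ u) (there t∈) =
  trans (cong length (filter-reject (t ≟_) λ { refl → All.lookup v∉ t∈ refl })) (count≡-∈ u t∈)

count<-suc : ∀ t (xs : List ℕ) → count< (suc t) xs ≡ count< t xs + count≡ t xs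
count<-suc t [] = refl
count<-suc t (v ∷ xs) with <-cmp v t
... | tri< v<t v≢t _
  rewrite dec-true (v <? suc t) (m<n⇒m<1+n v<t) | dec-true (v <? t) v<t | dec-false (t ≟ v) (v≢t ∘ sym) =
  cong suc (count<-suc t xs)
... | tri≈ v≮t refl _
  rewrite dec-true (v <? suc v) ≤-refl | dec-false (v <? v) v≮t | dec-true (v ≟ v) refl =
  trans (cong suc (count<-suc v xs)) (sym (+-suc _ _))
... | tri> v≮t v≢t v>t
  rewrite dec-false (v <? suc t) (<⇒≱ (s≤s v>t)) | dec-false (v <? t) v≮t | dec-false (t ≟ v) (v≢t ∘ sym) =
  count<-suc t xs

count<-≤-∷ : ∀ t v xs → count< t xs ≤ count< t (v ∷ xs)
count<-≤-∷ t v xs with v <? t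
... | yes v<t = ≤-trans (n≤1+n _) (≤-reflexive (sym (cong length (filter-accept (_<? t) v<t))))
... | no v≮t = ≤-reflexive (sym (cong length (filter-reject (_<? t) v≮t)))

-- Columns of the Rothe diagram

_∈ᵇ_ : ℕ → List ℕ → Bool
c ∈ᵇ vs = anyB (λ v → does (v ≟ c)) vs

∈ᵇ-true : ∀ {c vs} → c ∈ vs → c ∈ᵇ vs ≡ true
∈ᵇ-true {c} {v ∷ vs} (here refl) rewrite dec-true (v ≟ v) refl = refl
∈ᵇ-true {c} {v ∷ vs} (there c∈vs) rewrite ∈ᵇ-true c∈vs = ∨-zeroʳ _

∈ᵇ-false : ∀ {c} vs → c ∉ vs → c ∈ᵇ vs ≡ false
∈ᵇ-false [] c∉vs = refl
∈ᵇ-false {c} (v ∷ vs) c∉vs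
  rewrite dec-false (v ≟ c) (λ { refl → c∉vs (here refl) }) = ∈ᵇ-false vs (c∉vs ∘ there)

∈ᵇ-++-∉ : ∀ {c} xs {ys} → c ∉ ys → c ∈ᵇ (xs ++ ys) ≡ c ∈ᵇ xs
∈ᵇ-++-∉ [] c∉ys = ∈ᵇ-false _ c∉ys
∈ᵇ-++-∉ {c} (x ∷ xs) c∉ys = cong (does (x ≟ c) ∨_) (∈ᵇ-++-∉ xs c∉ys)

-- Column c of the Rothe diagram of w, the cell (i, c) recorded as the value w_i: the entries
-- larger than c that stand before c in w.
greaterBefore : ℕ → List ℕ → List ℕ
greaterBefore c [] = []
greaterBefore c (v ∷ vs) =
  if does (c <? v) ∧ c ∈ᵇ vs then v ∷ greaterBefore c vs else greaterBefore c vs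

greaterBefore-∷⁺ : ∀ c v vs → c < v → c ∈ vs → greaterBefore c (v ∷ vs) ≡ v ∷ greaterBefore c vs
greaterBefore-∷⁺ c v vs c<v c∈vs rewrite dec-true (c <? v) c<v | ∈ᵇ-true c∈vs = refl

greaterBefore-∷-≮ : ∀ c v vs → ¬ c < v → greaterBefore c (v ∷ vs) ≡ greaterBefore c vs
greaterBefore-∷-≮ c v vs c≮v rewrite dec-false (c <? v) c≮v = refl

greaterBefore-∷-∉ : ∀ c v vs → c ∉ vs → greaterBefore c (v ∷ vs) ≡ greaterBefore c vs
greaterBefore-∷-∉ c v vs c∉vs rewrite ∈ᵇ-false vs c∉vs | ∧-zeroʳ (does (c <? v)) = refl

greaterBefore-∉ : ∀ c vs → c ∉ vs → greaterBefore c vs ≡ []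
greaterBefore-∉ c [] c∉vs = refl
greaterBefore-∉ c (v ∷ vs) c∉vs =
  trans (greaterBefore-∷-∉ c v vs (c∉vs ∘ there)) (greaterBefore-∉ c vs (c∉vs ∘ there))

greaterBefore-> : ∀ c vs → All (c <_) (greaterBefore c vs)
greaterBefore-> c [] = []
greaterBefore-> c (v ∷ vs) with c <? v
... | no c≮v rewrite dec-false (c <? v) c≮v = greaterBefore-> c vs
... | yes c<v rewrite dec-true (c <? v) c<v with c ∈ᵇ vs
...   | true = c<v ∷ greaterBefore-> c vs
...   | false = greaterBefore-> c vs

length-greaterBefore : ∀ c vs → length (greaterBefore c vs) ≤ count> c vs
length-greaterBefore c [] = z≤n
length-greaterBefore c (v ∷ vs) with c <? v
... | no c≮v rewrite dec-false (c <? v) c≮v = length-greaterBefore c vs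
... | yes c<v rewrite dec-true (c <? v) c<v with c ∈ᵇ vs
...   | true = s≤s (length-greaterBefore c vs)
...   | false = m≤n⇒m≤1+n (length-greaterBefore c vs)

greaterBefore-++-∉ : ∀ c xs ys → c ∉ ys → greaterBefore c (xs ++ ys) ≡ greaterBefore c xs
greaterBefore-++-∉ c [] ys c∉ys = greaterBefore-∉ c ys c∉ys
greaterBefore-++-∉ c (v ∷ xs) ys c∉ys rewrite ∈ᵇ-++-∉ xs c∉ys with does (c <? v) ∧ c ∈ᵇ xs
... | true = cong (v ∷_) (greaterBefore-++-∉ c xs ys c∉ys)
... | false = greaterBefore-++-∉ c xs ys c∉ys

greaterBefore-++-∈ : ∀ c xs ys → c ∈ ys →
  greaterBefore c (xs ++ ys) ≡ filter (c <?_) xs ++ greaterBefore c ys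
greaterBefore-++-∈ c [] ys c∈ys = refl
greaterBefore-++-∈ c (v ∷ xs) ys c∈ys
  rewrite ∈ᵇ-true (∈-++⁺ʳ xs c∈ys) | ∧-identityʳ (does (c <? v)) with does (c <? v)
... | true = cong (v ∷_) (greaterBefore-++-∈ c xs ys c∈ys)
... | false = greaterBefore-++-∈ c xs ys c∈ys

greaterBefore-from : ∀ c p n → greaterBefore c (from p n) ≡ []
greaterBefore-from c p zero = refl
greaterBefore-from c p (suc n) = trans (cong (greaterBefore c) (from-suc p n)) (dropHead (c <? p))
  where
  dropHead : Dec (c < p) → greaterBefore c (p ∷ from (suc p) n) ≡ []
  dropHead (yes c<p) = trans
    (greaterBefore-∷-∉ c p (from (suc p) n) (<-asym c<p ∘ proj₁ ∘ ∈-from⁻ (suc p) n))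
    (greaterBefore-from c (suc p) n)
  dropHead (no c≮p) = trans
    (greaterBefore-∷-≮ c p (from (suc p) n) c≮p)
    (greaterBefore-from c (suc p) n)

anyB-map : ∀ P (f : ℕ → ℕ) l → anyB P (map f l) ≡ anyB (P ∘ f) l
anyB-map P f [] = refl
anyB-map P f (j ∷ l) = cong (P (f j) ∨_) (anyB-map P f l)

anyB-∧ʳ : ∀ P b (l : List ℕ) → anyB (λ j → P j ∧ b) l ≡ anyB P l ∧ b
anyB-∧ʳ P b [] = refl
anyB-∧ʳ P b (j ∷ l) =
  trans (cong (P j ∧ b ∨_) (anyB-∧ʳ P b l)) (sym (∧-distribʳ-∨ b (P j) (anyB P l)))

filterB-map : ∀ P (f : ℕ → ℕ) l → filterB P (map f l) ≡ map f (filterB (P ∘ f) l)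
filterB-map P f [] = refl
filterB-map P f (j ∷ l) with P (f j)
... | true = cong (f j ∷_) (filterB-map P f l)
... | false = filterB-map P f l

filterB-cong : ∀ {P Q : ℕ → Bool} → (∀ j → P j ≡ Q j) → ∀ l → filterB P l ≡ filterB Q l
filterB-cong P≗Q [] = refl
filterB-cong {P} {Q} P≗Q (j ∷ l) rewrite P≗Q j with Q j
... | true = cong (j ∷_) (filterB-cong P≗Q l)
... | false = filterB-cong P≗Q l

map-if : ∀ (f : ℕ → ℕ) b x l →
  map f (if b then x ∷ l else l) ≡ (if b then f x ∷ map f l else map f l)
map-if f true x l = refl
map-if f false x l = refl

-- oneTo n unfolds to map suc (upTo n); writing rows as suc p makes row suc (suc p) of v ∷ vs
-- definitionally row suc p of vs.
inRothe-head : ∀ c v vs → inRothe (v ∷ vs) 1 c ≡ does (c <? v) ∧ c ∈ᵇ vs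
inRothe-head c v vs = begin
  anyB T (map suc (upTo (suc m)))                       ≡⟨ anyB-map T suc (upTo (suc m)) ⟩
  anyB (T ∘ suc) (upTo (suc m))                         ≡⟨ cong (anyB (T ∘ suc)) (upTo-suc m) ⟩
  anyB (T ∘ suc) (0 ∷ map suc (upTo m))                 ≡⟨ anyB-map (T ∘ suc) suc (upTo m) ⟩
  anyB (λ q → does (nth (suc q) vs ≟ c) ∧ does (c <? v)) (upTo m) ≡⟨ anyB-∧ʳ _ _ (upTo m) ⟩
  anyB (λ q → does (nth (suc q) vs ≟ c)) (upTo m) ∧ does (c <? v)
    ≡⟨ cong (_∧ does (c <? v)) (sym (anyB-map _ _ (upTo m))) ⟩
  anyB (λ u → does (u ≟ c)) (map (λ q → nth (suc q) vs) (upTo m)) ∧ does (c <? v)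
    ≡⟨ cong (λ vs′ → anyB (λ u → does (u ≟ c)) vs′ ∧ does (c <? v)) (map-nth-upTo vs) ⟩
  c ∈ᵇ vs ∧ does (c <? v)                               ≡⟨ ∧-comm (c ∈ᵇ vs) _ ⟩
  does (c <? v) ∧ c ∈ᵇ vs                               ∎
  where
  open ≡-Reasoning
  m = length vs
  T : ℕ → Bool
  T j = does (1 <? j) ∧ does (nth j (v ∷ vs) ≟ c) ∧ does (c <? v)

inRothe-tail : ∀ c v vs p → inRothe (v ∷ vs) (suc (suc p)) c ≡ inRothe vs (suc p) c
inRothe-tail c v vs p = begin
  anyB U (map suc (upTo (suc m)))        ≡⟨ anyB-map U suc (upTo (suc m)) ⟩
  anyB (U ∘ suc) (upTo (suc m))          ≡⟨ cong (anyB (U ∘ suc)) (upTo-suc m) ⟩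
  anyB (U ∘ suc) (0 ∷ map suc (upTo m))  ≡⟨ anyB-map (U ∘ suc) suc (upTo m) ⟩
  anyB (V ∘ suc) (upTo m)                ≡⟨ sym (anyB-map V suc (upTo m)) ⟩
  anyB V (map suc (upTo m))              ∎
  where
  open ≡-Reasoning
  m = length vs
  U V : ℕ → Bool
  U j = does (suc (suc p) <? j) ∧ does (nth j (v ∷ vs) ≟ c) ∧ does (c <? nth (suc p) vs)
  V j = does (suc p <? j) ∧ does (nth j vs ≟ c) ∧ does (c <? nth (suc p) vs)

rotheRows-values : ∀ c ω →
  map (λ p → nth (suc p) ω) (filterB (λ p → inRothe ω (suc p) c) (upTo (length ω))) ≡ greaterBefore c ω
rotheRows-values c [] = refl
rotheRows-values c (v ∷ vs) = begin
  map N (filterB S (upTo (suc m)))                  ≡⟨ cong (map N ∘ filterB S) (upTo-suc m) ⟩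
  map N (filterB S (0 ∷ map suc (upTo m)))          ≡⟨ map-if N (S 0) 0 _ ⟩
  (if S 0 then v ∷ rest else rest)
    ≡⟨ cong₂ (λ b l → if b then v ∷ l else l) (inRothe-head c v vs) restValues ⟩
  greaterBefore c (v ∷ vs)                           ∎
  where
  open ≡-Reasoning
  m = length vs
  N = λ p → nth (suc p) (v ∷ vs)
  S = λ p → inRothe (v ∷ vs) (suc p) c
  rest = map N (filterB S (map suc (upTo m)))
  restValues : rest ≡ greaterBefore c vs
  restValues = begin
    map N (filterB S (map suc (upTo m)))              ≡⟨ cong (map N) (filterB-map S suc (upTo m)) ⟩
    map N (map suc (filterB (S ∘ suc) (upTo m)))      ≡⟨ sym (map-∘ _) ⟩
    map (λ p → nth (suc p) vs) (filterB (S ∘ suc) (upTo m))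
      ≡⟨ cong (map _) (filterB-cong (inRothe-tail c v vs) (upTo m)) ⟩
    map (λ p → nth (suc p) vs) (filterB (λ p → inRothe vs (suc p) c) (upTo m)) ≡⟨ rotheRows-values c vs ⟩
    greaterBefore c vs                                ∎

rotheColumn-values : ∀ c ω → map (λ i → nth i ω) (rotheColumn ω c) ≡ greaterBefore c ω
rotheColumn-values c ω = trans (cong (map _) (filterB-map _ suc (upTo (length ω))))
  (trans (sym (map-∘ _)) (rotheRows-values c ω))

-- Sliding

slideCase : ℕ → ℕ → List ℕ → Maybe ℕ → Bool → Maybe ℕ
slideCase f a ks nothing b =
  if b
  then (if does (nth a ks ≟ 1) then nothing
        else if does (2 ≤? nth a ks) then slideF f (suc a) (suc a) ks else nothing)
  else just a
slideCase f a ks (just i) b =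
  if does ((a ∸ i) <? nth i ks)
  then (if does (suc (a ∸ i) <? nth i ks) then slideF f (suc a) (suc i) ks else nothing)
  else just i

slideF-unfold : ∀ f a p ks → slideF (suc f) a p ks ≡
  slideCase f a ks (leftmost (onDiag ks (a ∸ 1)) (from p (a ∸ p))) (anyB (onDiag ks a) (from p (suc a ∸ p)))
slideF-unfold f a p ks with leftmost (onDiag ks (a ∸ 1)) (from p (a ∸ p))
... | nothing = refl
... | just i = refl

onDiag-false : ∀ ks d t → t + nth t ks ≤ d → onDiag ks d t ≡ false
onDiag-false ks d t t+k≤d with m≤n⇒∃[o]m+o≡n (≤-trans (m≤m+n t (nth t ks)) t+k≤d)
... | o , refl rewrite m+n∸m≡n t o
  | dec-false (o <? nth t ks) (λ o<k → <⇒≱ (+-monoʳ-< t o<k) t+k≤d) = ∧-zeroʳ _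

onDiag-true : ∀ ks d t → t ≤ d → d < t + nth t ks → onDiag ks d t ≡ true
onDiag-true ks d t t≤d d<t+k with m≤n⇒∃[o]m+o≡n t≤d
... | o , refl rewrite m+n∸m≡n t o | dec-true (t ≤? t + o) t≤d
  | dec-true (o <? nth t ks) (+-cancelˡ-< t o _ d<t+k) = refl

leftmost-from-skip : ∀ P p n → P p ≡ false → leftmost P (from p (suc n)) ≡ leftmost P (from (suc p) n)
leftmost-from-skip P p n Pp = trans (cong (leftmost P) (from-suc p n))
  (cong (λ b → if b then just p else leftmost P (from (suc p) n)) Pp)

leftmost-from-hit : ∀ P p n → P p ≡ true → leftmost P (from p (suc n)) ≡ just p
leftmost-from-hit P p n Pp = trans (cong (leftmost P) (from-suc p n))
  (cong (λ b → if b then just p else leftmost P (from (suc p) n)) Pp)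

anyB-from-skip : ∀ P p n → P p ≡ false → anyB P (from p (suc n)) ≡ anyB P (from (suc p) n)
anyB-from-skip P p n Pp = trans (cong (anyB P) (from-suc p n)) (cong (_∨ anyB P (from (suc p) n)) Pp)

-- The top cell of tower p lies on the diagonal p + nth p ks ∸ 1.
module _ (ks : List ℕ) where

  private
    searchFrom : ∀ {P : ℕ → Bool} {p m n} → m ≡ suc n →
      leftmost P (from p m) ≡ leftmost P (from p (suc n))
    searchFrom = cong (λ m → leftmost _ (from _ m))

    anyFrom : ∀ {P : ℕ → Bool} {p m n} → m ≡ n → anyB P (from p m) ≡ anyB P (from p n)
    anyFrom = cong (λ m → anyB _ (from _ m))

    noSearchBelow : ∀ p → leftmost (onDiag ks (p ∸ 1)) (from p (p ∸ p)) ≡ nothing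
    noSearchBelow p = cong (λ m → leftmost (onDiag ks (p ∸ 1)) (from p m)) (n∸n≡0 p)

    searchOwnTower : ∀ p → anyB (onDiag ks p) (from p (suc p ∸ p)) ≡ onDiag ks p p ∨ false
    searchOwnTower p = trans (anyFrom (m+n∸n≡m 1 p)) (cong (anyB (onDiag ks p)) (from-suc p 0))

    hitTower : ∀ a p → p ≤ a → a < p + nth p ks →
      leftmost (onDiag ks a) (from p (suc a ∸ p)) ≡ just p
    hitTower a p p≤a a<p+k =
      trans (searchFrom (+-∸-assoc 1 p≤a)) (leftmost-from-hit _ p (a ∸ p) (onDiag-true ks a p p≤a a<p+k))

  slideF-S1a : ∀ f a p → leftmost (onDiag ks (a ∸ 1)) (from p (a ∸ p)) ≡ nothing →
    anyB (onDiag ks a) (from p (suc a ∸ p)) ≡ false → slideF (suc f) a p ks ≡ just a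
  slideF-S1a f a p noneBelow noneOn rewrite slideF-unfold f a p ks | noneBelow | noneOn = refl

  slideF-S1c : ∀ f a p → leftmost (onDiag ks (a ∸ 1)) (from p (a ∸ p)) ≡ nothing →
    anyB (onDiag ks a) (from p (suc a ∸ p)) ≡ true → 2 ≤ nth a ks →
    slideF (suc f) a p ks ≡ slideF f (suc a) (suc a) ks
  slideF-S1c f a p noneBelow someOn 2≤k rewrite slideF-unfold f a p ks | noneBelow | someOn
    | dec-false (nth a ks ≟ 1) (λ k≡1 → <-irrefl (sym k≡1) 2≤k) | dec-true (2 ≤? nth a ks) 2≤k = refl

  slideF-S2a : ∀ f a p i → leftmost (onDiag ks (a ∸ 1)) (from p (a ∸ p)) ≡ just i →
    ¬ (a ∸ i < nth i ks) → slideF (suc f) a p ks ≡ just i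
  slideF-S2a f a p i leftmostBelow a∸i≮k rewrite slideF-unfold f a p ks | leftmostBelow
    | dec-false ((a ∸ i) <? nth i ks) a∸i≮k = refl

  slideF-S2c : ∀ f a p i → leftmost (onDiag ks (a ∸ 1)) (from p (a ∸ p)) ≡ just i →
    suc (a ∸ i) < nth i ks → slideF (suc f) a p ks ≡ slideF f (suc a) (suc i) ks
  slideF-S2c f a p i leftmostBelow lt rewrite slideF-unfold f a p ks | leftmostBelow
    | dec-true ((a ∸ i) <? nth i ks) (<-trans (n<1+n _) lt) | dec-true (suc (a ∸ i) <? nth i ks) lt = refl

  slideF-skip : ∀ f a p → p < a → p + nth p ks < a →
    slideF (suc f) a p ks ≡ slideF (suc f) a (suc p) ks
  slideF-skip f (suc a) p (s≤s p≤a) p+k<a = begin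
    slideF (suc f) (suc a) p ks
      ≡⟨ slideF-unfold f (suc a) p ks ⟩
    slideCase f (suc a) ks (leftmost (onDiag ks a) (from p (suc a ∸ p)))
                           (anyB (onDiag ks (suc a)) (from p (suc (suc a) ∸ p)))
      ≡⟨ cong₂ (slideCase f (suc a) ks) skipBelow skipOn ⟩
    slideCase f (suc a) ks (leftmost (onDiag ks a) (from (suc p) (a ∸ p)))
                           (anyB (onDiag ks (suc a)) (from (suc p) (suc a ∸ p)))
      ≡⟨ sym (slideF-unfold f (suc a) (suc p) ks) ⟩
    slideF (suc f) (suc a) (suc p) ks ∎
    where
    open ≡-Reasoning
    skipBelow = trans (searchFrom (+-∸-assoc 1 p≤a))
      (leftmost-from-skip _ p (a ∸ p) (onDiag-false ks a p (≤-pred p+k<a)))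
    skipOn = trans (anyFrom (+-∸-assoc 1 (m≤n⇒m≤1+n p≤a)))
      (anyB-from-skip _ p (suc a ∸ p) (onDiag-false ks (suc a) p (<⇒≤ p+k<a)))

  slideF-stop : ∀ f a p → p ≤ a → p + nth p ks ≡ a → slideF (suc f) a p ks ≡ just p
  slideF-stop f a p p≤a p+k≡a with m≤n⇒m<n∨m≡n p≤a
  ... | inj₂ refl = slideF-S1a f p p (noSearchBelow p)
    (trans (searchOwnTower p) (cong (_∨ false) (onDiag-false ks p p (≤-reflexive p+k≡a))))
  ... | inj₁ (s≤s {n = a'} p≤a') = slideF-S2a f (suc a') p p (hitTower a' p p≤a' (≤-reflexive (sym p+k≡a)))
    (<-irrefl (trans (cong (_∸ p) (sym p+k≡a)) (m+n∸m≡n p (nth p ks))))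

  slideF-climb : ∀ f a p → p ≤ a → 2 + a ≤ p + nth p ks →
    slideF (suc f) a p ks ≡ slideF f (suc a) (suc p) ks
  slideF-climb f a p p≤a 2+a≤p+k with m≤n⇒m<n∨m≡n p≤a
  ... | inj₂ refl = slideF-S1c f p p (noSearchBelow p)
    (trans (searchOwnTower p) (cong (_∨ false) (onDiag-true ks p p ≤-refl (m<m+n p (<-trans z<s 2≤k)))))
    2≤k
    where
    2≤k : 2 ≤ nth p ks
    2≤k = +-cancelˡ-≤ p 2 _ (subst (_≤ p + nth p ks) (+-comm 2 p) 2+a≤p+k)
  ... | inj₁ (s≤s {n = a'} p≤a') = slideF-S2c f (suc a') p p
    (hitTower a' p p≤a' (≤-trans (n≤1+n _) (≤-trans (n≤1+n _) 2+a≤p+k))) room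
    where
    room : suc (suc (suc a' ∸ p)) ≤ nth p ks
    room = +-cancelˡ-≤ p _ _ (subst (_≤ p + nth p ks) (sym (begin
      p + suc (suc (suc a' ∸ p)) ≡⟨ +-suc p _ ⟩
      suc (p + suc (suc a' ∸ p)) ≡⟨ cong suc (+-suc p _) ⟩
      suc (suc (p + (suc a' ∸ p))) ≡⟨ cong (suc ∘ suc) (m+[n∸m]≡n p≤a) ⟩
      2 + suc a' ∎)) 2+a≤p+k)
      where open ≡-Reasoning

-- The letter a = |P| + 1 meets tower t ≤ x on the diagonal a + #{q ∈ Q | q < t}: a tower t ∈ P
-- lies below that diagonal and is passed, a tower t ∈ Q sticks out of it by two cells (x and y
-- both lie in column t) and lifts the slide by one diagonal, and tower x ends just below it.
module Ascent (P : List ℕ) (x y : ℕ) (Q : List ℕ) (x<y : x < y)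
  (perm : P ++ x ∷ y ∷ Q ↭ oneTo (length (P ++ x ∷ y ∷ Q))) where

  w w′ : List ℕ
  w = P ++ x ∷ y ∷ Q
  w′ = P ++ y ∷ x ∷ Q

  private
    n : ℕ
    n = length w

    distinct : Unique w
    distinct = Unique-↭ (↭-sym perm) (Unique-from 1 n)

    uniqueP : Unique P
    uniqueP = proj₁ (Unique-++⁻ P distinct)

    uniqueQ : Unique Q
    uniqueQ with proj₁ (proj₂ (Unique-++⁻ P distinct))
    ... | _ ∷ _ ∷ uQ = uQ

    P∉R : ∀ {v} → v ∈ P → v ∉ x ∷ y ∷ Q
    P∉R = proj₂ (proj₂ (Unique-++⁻ P distinct))

    x∉yQ : x ∉ y ∷ Q
    x∉yQ = Unique[x∷xs]⇒x∉xs (proj₁ (proj₂ (Unique-++⁻ P distinct)))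

    x∉P : x ∉ P
    x∉P x∈P = P∉R x∈P (here refl)

    y∉P : y ∉ P
    y∉P y∈P = P∉R y∈P (there (here refl))

  greaterBefore-x : greaterBefore x w ≡ filter (x <?_) P
  greaterBefore-x = begin
    greaterBefore x w                               ≡⟨ greaterBefore-++-∈ x P (x ∷ y ∷ Q) (here refl) ⟩
    filter (x <?_) P ++ greaterBefore x (x ∷ y ∷ Q) ≡⟨ cong (filter (x <?_) P ++_) nothingAfter ⟩
    filter (x <?_) P ++ []                          ≡⟨ ++-identityʳ _ ⟩
    filter (x <?_) P                                ∎
    where
    open ≡-Reasoning
    nothingAfter : greaterBefore x (x ∷ y ∷ Q) ≡ []
    nothingAfter = trans (greaterBefore-∷-≮ x x (y ∷ Q) (<-irrefl refl)) (greaterBefore-∉ x (y ∷ Q) x∉yQ)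

  greaterBefore′-x : greaterBefore x w′ ≡ greaterBefore x w ++ [ y ]
  greaterBefore′-x = begin
    greaterBefore x w′
      ≡⟨ greaterBefore-++-∈ x P (y ∷ x ∷ Q) (there (here refl)) ⟩
    filter (x <?_) P ++ greaterBefore x (y ∷ x ∷ Q)
      ≡⟨ cong (filter (x <?_) P ++_) (greaterBefore-∷⁺ x y (x ∷ Q) x<y (here refl)) ⟩
    filter (x <?_) P ++ y ∷ greaterBefore x (x ∷ Q)
      ≡⟨ cong (λ l → filter (x <?_) P ++ y ∷ l) nothingAfter ⟩
    filter (x <?_) P ++ [ y ]
      ≡⟨ cong (_++ [ y ]) (sym greaterBefore-x) ⟩
    greaterBefore x w ++ [ y ] ∎
    where
    open ≡-Reasoning
    nothingAfter : greaterBefore x (x ∷ Q) ≡ []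
    nothingAfter = trans (greaterBefore-∷-≮ x x Q (<-irrefl refl)) (greaterBefore-∉ x Q (x∉yQ ∘ there))

  y∉greaterBefore-x : y ∉ greaterBefore x w
  y∉greaterBefore-x y∈ rewrite greaterBefore-x = y∉P (proj₁ (∈-filter⁻ (x <?_) y∈))

  private
    swappedPair : ∀ c → c ≢ x → greaterBefore c (y ∷ x ∷ Q) ↭ greaterBefore c (x ∷ y ∷ Q)
    swappedPair c c≢x with y ≟ c
    ... | yes refl = ↭-reflexive (begin
      greaterBefore y (y ∷ x ∷ Q) ≡⟨ greaterBefore-∷-≮ y y (x ∷ Q) (<-irrefl refl) ⟩
      greaterBefore y (x ∷ Q)     ≡⟨ greaterBefore-∷-≮ y x Q (<-asym x<y) ⟩
      greaterBefore y Q           ≡⟨ sym (greaterBefore-∷-≮ y y Q (<-irrefl refl)) ⟩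
      greaterBefore y (y ∷ Q)     ≡⟨ sym (greaterBefore-∷-≮ y x (y ∷ Q) (<-asym x<y)) ⟩
      greaterBefore y (x ∷ y ∷ Q) ∎)
      where open ≡-Reasoning
    ... | no y≢c rewrite dec-false (y ≟ c) y≢c | dec-false (x ≟ c) (c≢x ∘ sym)
      with does (c <? y) | does (c <? x) | c ∈ᵇ Q
    ... | true | true | true = ↭-swap y x ↭-refl
    ... | true | false | true = ↭-refl
    ... | false | true | true = ↭-refl
    ... | false | false | true = ↭-refl
    ... | c<y | c<x | false rewrite ∧-zeroʳ c<y | ∧-zeroʳ c<x = ↭-refl

  greaterBefore′-≢x : ∀ c → c ≢ x → greaterBefore c w′ ↭ greaterBefore c w
  greaterBefore′-≢x c c≢x with c ∈? x ∷ y ∷ Q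
  ... | yes c∈R
    rewrite greaterBefore-++-∈ c P _ c∈R
          | greaterBefore-++-∈ c P (y ∷ x ∷ Q) (∈-resp-↭ (↭-swap x y ↭-refl) c∈R) =
    ++⁺ˡ (filter (c <?_) P) (swappedPair c c≢x)
  ... | no c∉R
    rewrite greaterBefore-++-∉ c P _ c∉R
          | greaterBefore-++-∉ c P (y ∷ x ∷ Q) (c∉R ∘ ∈-resp-↭ (↭-swap y x ↭-refl)) = ↭-refl

  1≤x : 1 ≤ x
  1≤x = proj₁ (∈-from⁻ 1 n (∈-resp-↭ perm (∈-++⁺ʳ P (here refl))))

  private
    x≤n : x ≤ n
    x≤n = ≤-pred (proj₂ (∈-from⁻ 1 n (∈-resp-↭ perm (∈-++⁺ʳ P (here refl)))))

    ∈w : ∀ {t} → 1 ≤ t → t ≤ n → t ∈ w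
    ∈w 1≤t t≤n = ∈-resp-↭ (↭-sym perm) (∈-from⁺ 1 n 1≤t (s≤s t≤n))

    count<-below-x : ∀ t → t ≤ x → count< t P + count< t Q ≡ t ∸ 1
    count<-below-x t t≤x = begin
      count< t P + count< t Q             ≡⟨ cong (count< t P +_) (sym (cong length xyAbove)) ⟩
      count< t P + count< t (x ∷ y ∷ Q)   ≡⟨ sym (count<-++ t P (x ∷ y ∷ Q)) ⟩
      count< t w                          ≡⟨ count<-↭ t perm ⟩
      count< t (from 1 n)                 ≡⟨ count<-from t 1 n (≤-trans t≤x (m≤n⇒m≤1+n x≤n)) ⟩
      t ∸ 1                               ∎
      where
      open ≡-Reasoning
      xyAbove : filter (_<? t) (x ∷ y ∷ Q) ≡ filter (_<? t) Q
      xyAbove = trans (filter-reject (_<? t) (≤⇒≯ t≤x)) (filter-reject (_<? t) (≤⇒≯ (≤-trans t≤x (<⇒≤ x<y))))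

  a : ℕ
  a = suc (length P)

  diagonal : ∀ t → 1 ≤ t → t ≤ x → a + count< t Q ≡ t + count> t P + count≡ t P
  diagonal t 1≤t t≤x = begin
    suc (length P) + C       ≡⟨ cong (λ m → suc m + C) (sym (count-trichotomy t P)) ⟩
    suc (L + G + E) + C      ≡⟨ rearrange L G E C ⟩
    suc (L + C) + G + E      ≡⟨ cong (λ m → suc m + G + E) (count<-below-x t t≤x) ⟩
    suc (t ∸ 1) + G + E      ≡⟨ cong (λ m → m + G + E) (m+[n∸m]≡n 1≤t) ⟩
    t + G + E                ∎
    where
    open ≡-Reasoning
    L = count< t P
    G = count> t P
    E = count≡ t P
    C = count< t Q
    rearrange : ∀ L G E C → suc (L + G + E) + C ≡ suc (L + C) + G + E
    rearrange = solve-∀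

  height-∈P : ∀ t → t ∈ P → 1 ≤ t → t < x → t + length (greaterBefore t w) < a + count< t Q
  height-∈P t t∈P 1≤t t<x = begin-strict
    t + length (greaterBefore t w)  ≡⟨ cong (λ l → t + length l) (greaterBefore-++-∉ t P _ (P∉R t∈P)) ⟩
    t + length (greaterBefore t P)  ≤⟨ +-monoʳ-≤ t (length-greaterBefore t P) ⟩
    t + count> t P                  <⟨ m<m+n (t + count> t P) z<s ⟩
    t + count> t P + 1              ≡⟨ cong (t + count> t P +_) (sym (count≡-∈ uniqueP t∈P)) ⟩
    t + count> t P + count≡ t P     ≡⟨ sym (diagonal t 1≤t (<⇒≤ t<x)) ⟩
    a + count< t Q                  ∎
    where open ≤-Reasoning

  height-∈Q : ∀ t → t ∈ Q → 1 ≤ t → t < x → 2 + (a + count< t Q) ≤ t + length (greaterBefore t w)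
  height-∈Q t t∈Q 1≤t t<x = begin
    2 + (a + count< t Q)
      ≡⟨ cong (2 +_) (diagonal t 1≤t (<⇒≤ t<x)) ⟩
    2 + (t + G + count≡ t P)
      ≡⟨ cong (λ e → 2 + (t + G + e)) (count≡-∉ P (λ t∈P → P∉R t∈P (there (there t∈Q)))) ⟩
    2 + (t + G + 0)
      ≡⟨ rearrange t G ⟩
    t + (G + 2)
      ≤⟨ +-monoʳ-≤ t (+-monoʳ-≤ G (s≤s (s≤s z≤n))) ⟩
    t + (G + length (x ∷ y ∷ greaterBefore t Q))
      ≡⟨ cong (t +_) (sym (length-++ (filter (t <?_) P))) ⟩
    t + length (filter (t <?_) P ++ x ∷ y ∷ greaterBefore t Q)
      ≡⟨ cong (λ l → t + length l) (sym column) ⟩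
    t + length (greaterBefore t w) ∎
    where
    open ≤-Reasoning
    G = count> t P
    rearrange : ∀ t G → 2 + (t + G + 0) ≡ t + (G + 2)
    rearrange = solve-∀
    column : greaterBefore t w ≡ filter (t <?_) P ++ x ∷ y ∷ greaterBefore t Q
    column = trans (greaterBefore-++-∈ t P (x ∷ y ∷ Q) (there (there t∈Q)))
      (cong (filter (t <?_) P ++_) (trans (greaterBefore-∷⁺ t x (y ∷ Q) t<x (there t∈Q))
        (cong (x ∷_) (greaterBefore-∷⁺ t y Q (<-trans t<x x<y) t∈Q))))

  height-x : x + length (greaterBefore x w) ≡ a + count< x Q
  height-x = begin
    x + length (greaterBefore x w)  ≡⟨ cong (λ l → x + length l) greaterBefore-x ⟩
    x + count> x P                  ≡⟨ sym (+-identityʳ _) ⟩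
    x + count> x P + 0              ≡⟨ cong (x + count> x P +_) (sym (count≡-∉ P x∉P)) ⟩
    x + count> x P + count≡ x P     ≡⟨ sym (diagonal x 1≤x ≤-refl) ⟩
    a + count< x Q                  ∎
    where open ≡-Reasoning

  module _ (ks : List ℕ) (heights : ∀ t → 1 ≤ t → nth t ks ≡ length (greaterBefore t w)) where

    private
      slideF-reaches-x : ∀ k t d f → k + t ≡ x → 1 ≤ t → d ≡ a + count< t Q →
        length ks < f + t → slideF (suc f) d t ks ≡ just x
      passTower : ∀ k t d f → k + suc t ≡ x → t < x → 1 ≤ t → d ≡ a + count< t Q →
        length ks < f + t → slideF (suc f) d t ks ≡ just x

      slideF-reaches-x zero t d f refl 1≤t refl _ = slideF-stop ks f (a + count< x Q) x
        (subst (x ≤_) height-x (m≤m+n x _)) (trans (cong (x +_) (heights x 1≤t)) height-x)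
      slideF-reaches-x (suc k) t d f k+1+t≡x 1≤t d≡ fuel = passTower k t d f
        (trans (+-suc k t) k+1+t≡x) (subst (t <_) k+1+t≡x (s≤s (m≤n+m t k))) 1≤t d≡ fuel

      passTower k t d f k+1+t≡x t<x 1≤t refl fuel with ∈-++⁻ P (∈w 1≤t (<⇒≤ (<-≤-trans t<x x≤n)))
      ... | inj₁ t∈P = trans
        (slideF-skip ks f d t (≤-<-trans (m≤m+n t _) skip) skip)
        (slideF-reaches-x k (suc t) d f k+1+t≡x (s≤s z≤n) sameDiagonal
          (≤-trans fuel (+-monoʳ-≤ f (n≤1+n t))))
        where
        skip : t + nth t ks < d
        skip = subst (λ h → t + h < d) (sym (heights t 1≤t)) (height-∈P t t∈P 1≤t t<x)
        sameDiagonal : d ≡ a + count< (suc t) Q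
        sameDiagonal = cong (a +_) (sym (begin
          count< (suc t) Q           ≡⟨ count<-suc t Q ⟩
          count< t Q + count≡ t Q    ≡⟨ cong (count< t Q +_) (count≡-∉ Q (P∉R t∈P ∘ there ∘ there)) ⟩
          count< t Q + 0             ≡⟨ +-identityʳ _ ⟩
          count< t Q                 ∎))
          where open ≡-Reasoning
      ... | inj₂ (here refl) = ⊥-elim (<-irrefl refl t<x)
      ... | inj₂ (there (here refl)) = ⊥-elim (<-asym t<x x<y)
      ... | inj₂ (there (there t∈Q)) = climb f fuel
        where
        climbs : 2 + d ≤ t + nth t ks
        climbs = subst (λ h → 2 + d ≤ t + h) (sym (heights t 1≤t)) (height-∈Q t t∈Q 1≤t t<x)
        t≤d : t ≤ d
        t≤d = subst (t ≤_) (sym (diagonal t 1≤t (<⇒≤ t<x))) (≤-trans (m≤m+n t _) (m≤m+n _ _))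
        t≤|ks| : t ≤ length ks
        t≤|ks| = nth≢0⇒≤length t ks (+-cancelˡ-< t 0 _ (begin-strict
          t + 0          ≡⟨ +-identityʳ t ⟩
          t              ≤⟨ t≤d ⟩
          d              <⟨ n≤1+n _ ⟩
          2 + d          ≤⟨ climbs ⟩
          t + nth t ks   ∎))
          where open ≤-Reasoning
        nextDiagonal : suc d ≡ a + count< (suc t) Q
        nextDiagonal = begin
          suc (a + count< t Q)           ≡⟨ sym (+-suc a _) ⟩
          a + suc (count< t Q)           ≡⟨ cong (a +_) (+-comm 1 _) ⟩
          a + (count< t Q + 1)           ≡⟨ cong (λ e → a + (count< t Q + e)) (sym (count≡-∈ uniqueQ t∈Q)) ⟩
          a + (count< t Q + count≡ t Q)  ≡⟨ cong (a +_) (sym (count<-suc t Q)) ⟩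
          a + count< (suc t) Q           ∎
          where open ≡-Reasoning
        climb : ∀ f → length ks < f + t → slideF (suc f) d t ks ≡ just x
        climb zero fuel = ⊥-elim (<⇒≱ fuel t≤|ks|)
        climb (suc f) fuel = trans (slideF-climb ks (suc f) d t t≤d climbs)
          (slideF-reaches-x k (suc t) (suc d) f k+1+t≡x (s≤s z≤n) nextDiagonal
            (subst (length ks <_) (sym (+-suc f t)) fuel))

    slide-ascent : slide a ks ≡ just x
    slide-ascent = slideF-reaches-x (x ∸ 1) 1 a (suc (a + length ks + sum ks)) (m∸n+n≡m 1≤x) ≤-refl
      (sym (trans (cong (a +_) (m+n≡0⇒n≡0 (count< 1 P) (count<-below-x 1 1≤x))) (+-identityʳ a)))
      (≤-trans (s≤s (≤-trans (m≤n+m (length ks) a) (m≤m+n _ (sum ks)))) (m≤m+n _ 1))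

-- Reduced words apply ascents only

inversions-swap-< : ∀ (P : List ℕ) {x y} Q → x < y →
  inversions (P ++ y ∷ x ∷ Q) ≡ suc (inversions (P ++ x ∷ y ∷ Q))
inversions-swap-< [] {x} {y} Q x<y = begin
  count< y (x ∷ Q) + (count< x Q + I)
    ≡⟨ cong (λ m → length m + (count< x Q + I)) (filter-accept (_<? y) x<y) ⟩
  suc (count< y Q) + (count< x Q + I)
    ≡⟨ cong suc (x∙yz≈y∙xz (count< y Q) (count< x Q) I) ⟩
  suc (count< x Q + (count< y Q + I))
    ≡⟨ cong (λ m → suc (length m + (count< y Q + I))) (sym (filter-reject (_<? x) (<-asym x<y))) ⟩
  suc (count< x (y ∷ Q) + (count< y Q + I)) ∎
  where
  open ≡-Reasoning
  I = inversions Q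
inversions-swap-< (z ∷ P) {x} {y} Q x<y = begin
  count< z (P ++ y ∷ x ∷ Q) + inversions (P ++ y ∷ x ∷ Q)
    ≡⟨ cong₂ _+_ (count<-↭ z (↭-swap-middle P x y Q)) (inversions-swap-< P Q x<y) ⟩
  count< z (P ++ x ∷ y ∷ Q) + suc (inversions (P ++ x ∷ y ∷ Q))
    ≡⟨ +-suc _ _ ⟩
  suc (count< z (P ++ x ∷ y ∷ Q) + inversions (P ++ x ∷ y ∷ Q)) ∎
  where open ≡-Reasoning

inversions-swap-≮ : ∀ (P : List ℕ) {x y} Q → ¬ x < y →
  inversions (P ++ y ∷ x ∷ Q) ≤ inversions (P ++ x ∷ y ∷ Q)
inversions-swap-≮ [] {x} {y} Q x≮y = begin
  count< y (x ∷ Q) + (count< x Q + I)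
    ≡⟨ cong (λ m → length m + (count< x Q + I)) (filter-reject (_<? y) x≮y) ⟩
  count< y Q + (count< x Q + I)
    ≡⟨ x∙yz≈y∙xz (count< y Q) (count< x Q) I ⟩
  count< x Q + (count< y Q + I)
    ≤⟨ +-monoˡ-≤ (count< y Q + I) (count<-≤-∷ x y Q) ⟩
  count< x (y ∷ Q) + (count< y Q + I) ∎
  where
  open ≤-Reasoning
  I = inversions Q
inversions-swap-≮ (z ∷ P) {x} {y} Q x≮y = begin
  count< z (P ++ y ∷ x ∷ Q) + inversions (P ++ y ∷ x ∷ Q)
    ≡⟨ cong (_+ inversions (P ++ y ∷ x ∷ Q)) (count<-↭ z (↭-swap-middle P x y Q)) ⟩
  count< z (P ++ x ∷ y ∷ Q) + inversions (P ++ y ∷ x ∷ Q)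
    ≤⟨ +-monoʳ-≤ _ (inversions-swap-≮ P Q x≮y) ⟩
  count< z (P ++ x ∷ y ∷ Q) + inversions (P ++ x ∷ y ∷ Q) ∎
  where open ≤-Reasoning

data Ascents : List ℕ → List ℕ → Set where
  []     : ∀ {w} → Ascents w []
  ascent : ∀ P {x y} Q {as} → x < y → Ascents (P ++ y ∷ x ∷ Q) as →
           Ascents (P ++ x ∷ y ∷ Q) (suc (length P) ∷ as)

applyWord-inversions : ∀ n as (w : List ℕ) → All (λ a → 1 ≤ a × a < n) as → length w ≡ n →
  inversions (applyWord w as) ≤ inversions w + length as
applyWord-inversions n [] w _ _ = ≤-reflexive (sym (+-identityʳ _))
applyWord-inversions n (a ∷ as) w ((1≤a , a<n) ∷ inRange) refl
  with adjacentAt a w 1≤a a<n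
... | P , x , y , Q , refl , refl rewrite swapAt-middle P x y Q = begin
  inversions (applyWord (P ++ y ∷ x ∷ Q) as)
    ≤⟨ applyWord-inversions _ as _ inRange (↭-length (↭-swap-middle P x y Q)) ⟩
  inversions (P ++ y ∷ x ∷ Q) + length as
    ≤⟨ +-monoˡ-≤ (length as) oneMore ⟩
  suc (inversions (P ++ x ∷ y ∷ Q)) + length as
    ≡⟨ sym (+-suc _ _) ⟩
  inversions (P ++ x ∷ y ∷ Q) + suc (length as) ∎
  where
  open ≤-Reasoning
  oneMore : inversions (P ++ y ∷ x ∷ Q) ≤ suc (inversions (P ++ x ∷ y ∷ Q))
  oneMore with x <? y
  ... | yes x<y = ≤-reflexive (inversions-swap-< P Q x<y)
  ... | no x≮y = m≤n⇒m≤1+n (inversions-swap-≮ P Q x≮y)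

reduced⇒ascents : ∀ n as (w : List ℕ) → All (λ a → 1 ≤ a × a < n) as → length w ≡ n →
  inversions (applyWord w as) ≡ inversions w + length as → Ascents w as
reduced⇒ascents n [] w _ _ _ = []
reduced⇒ascents n (a ∷ as) w ((1≤a , a<n) ∷ inRange) refl reduced
  with adjacentAt a w 1≤a a<n
... | P , x , y , Q , refl , refl rewrite swapAt-middle P x y Q with x <? y
... | yes x<y = ascent P Q x<y (reduced⇒ascents _ as _ inRange (↭-length (↭-swap-middle P x y Q))
  (trans reduced (trans (+-suc _ _) (cong (_+ length as) (sym (inversions-swap-< P Q x<y))))))
... | no x≮y = ⊥-elim (<-irrefl reduced (begin-strict
  inversions (applyWord (P ++ y ∷ x ∷ Q) as)
    ≤⟨ applyWord-inversions _ as _ inRange (↭-length (↭-swap-middle P x y Q)) ⟩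
  inversions (P ++ y ∷ x ∷ Q) + length as
    ≤⟨ +-monoˡ-≤ (length as) (inversions-swap-≮ P Q x≮y) ⟩
  inversions (P ++ x ∷ y ∷ Q) + length as
    <⟨ +-monoʳ-< _ (n<1+n (length as)) ⟩
  inversions (P ++ x ∷ y ∷ Q) + suc (length as) ∎))
  where open ≤-Reasoning

inversions-from : ∀ p n → inversions (from p n) ≡ 0
inversions-from p zero = refl
inversions-from p (suc n) = begin
  inversions (from p (suc n))
    ≡⟨ cong inversions (from-suc p n) ⟩
  count< p (from (suc p) n) + inversions (from (suc p) n)
    ≡⟨ cong₂ _+_ (count<-from p (suc p) n (≤-trans (n≤1+n p) (m≤m+n (suc p) n))) (inversions-from (suc p) n) ⟩
  p ∸ suc p + 0
    ≡⟨ cong (_+ 0) (m≤n⇒m∸n≡0 (n≤1+n p)) ⟩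
  0 ∎
  where open ≡-Reasoning

-- A step (r, u, v) of swaps has u < v and creates the cell of D_α in column u.
columnSteps : ℕ → List (ℕ × ℕ × ℕ) → List ℕ
columnSteps c [] = []
columnSteps c ((r , u , v) ∷ ss) = if does (u ≟ c) then r ∷ columnSteps c ss else columnSteps c ss

columnSteps-∷ʳ : ∀ c ss k x y →
  columnSteps c (ss ++ [ (k , x , y) ]) ≡ columnSteps c ss ++ (if does (x ≟ c) then [ k ] else [])
columnSteps-∷ʳ c [] k x y = refl
columnSteps-∷ʳ c ((r , u , v) ∷ ss) k x y with does (u ≟ c)
... | true = cong (r ∷_) (columnSteps-∷ʳ c ss k x y)
... | false = columnSteps-∷ʳ c ss k x y

columnSteps-∷ʳ-same : ∀ ss k x y → columnSteps x (ss ++ [ (k , x , y) ]) ≡ columnSteps x ss ++ [ k ]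
columnSteps-∷ʳ-same ss k x y rewrite columnSteps-∷ʳ x ss k x y | dec-true (x ≟ x) refl = refl

columnSteps-∷ʳ-other : ∀ {c} ss k x y → c ≢ x →
  columnSteps c (ss ++ [ (k , x , y) ]) ≡ columnSteps c ss
columnSteps-∷ʳ-other {c} ss k x y c≢x
  rewrite columnSteps-∷ʳ c ss k x y | dec-false (x ≟ c) (c≢x ∘ sym) = ++-identityʳ _

canonicalColumn : List (ℕ × ℕ × ℕ) → List ℕ → ℕ → List ℕ
canonicalColumn ss w c = map (λ v → stepSwapping ss v c) (greaterBefore c w)

swapsValues-false : ∀ u v r x y → ¬ (x ≡ u × y ≡ v) → ¬ (x ≡ v × y ≡ u) →
  swapsValues u v (r , x , y) ≡ false
swapsValues-false u v r x y ¬uv ¬vu = cong₂ _∨_ (notBoth ¬uv) (notBoth ¬vu)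
  where
  notBoth : ∀ {p q} → ¬ (x ≡ p × y ≡ q) → does (x ≟ p) ∧ does (y ≟ q) ≡ false
  notBoth {p} {q} ¬pq with x ≟ p
  ... | no x≢p rewrite dec-false (x ≟ p) x≢p = refl
  ... | yes x≡p rewrite dec-true (x ≟ p) x≡p | dec-false (y ≟ q) (λ y≡q → ¬pq (x≡p , y≡q)) = refl

swapsValues-swapped : ∀ r x y → swapsValues y x (r , x , y) ≡ true
swapsValues-swapped r x y rewrite dec-true (x ≟ x) refl | dec-true (y ≟ y) refl = ∨-zeroʳ _

stepSwapping-∷ʳ-other : ∀ ss s u v → swapsValues u v s ≡ false →
  stepSwapping (ss ++ [ s ]) u v ≡ stepSwapping ss u v
stepSwapping-∷ʳ-other [] (r , x , y) u v other rewrite other = refl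
stepSwapping-∷ʳ-other ((r , x , y) ∷ ss) s u v other with swapsValues u v (r , x , y)
... | true = refl
... | false = stepSwapping-∷ʳ-other ss s u v other

stepSwapping-∷ʳ-first : ∀ ss r x y u v → (∀ {s} → s ∈ ss → swapsValues u v s ≡ false) →
  swapsValues u v (r , x , y) ≡ true → stepSwapping (ss ++ [ (r , x , y) ]) u v ≡ r
stepSwapping-∷ʳ-first [] r x y u v _ new rewrite new = refl
stepSwapping-∷ʳ-first (s ∷ ss) r x y u v earlier new rewrite earlier (here refl) =
  stepSwapping-∷ʳ-first ss r x y u v (earlier ∘ there) new

columnLabels-canonical : ∀ ω α c →
  columnLabels ω α c ≡ canonicalColumn (swaps 1 (oneTo (length ω)) α) ω c
columnLabels-canonical ω α c =
  trans (map-∘ (rotheColumn ω c)) (cong (map _) (rotheColumn-values c ω))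

columnSteps-swaps : ∀ c r w as →
  All (r ≤_) (columnSteps c (swaps r w as)) × AllPairs _<_ (columnSteps c (swaps r w as))
columnSteps-swaps c r w [] = [] , []
columnSteps-swaps c r w (a ∷ as) with columnSteps-swaps c (suc r) (swapAt a w) as | does (nth a w ≟ c)
... | later , sorted | true = ≤-refl ∷ All.map (≤-trans (n≤1+n r)) later , later ∷ sorted
... | later , sorted | false = All.map (≤-trans (n≤1+n r)) later , sorted

nth-sizes : ∀ t (T : TowerTableau) → 1 ≤ t → nth t (sizes T) ≡ length (tower t T)
nth-sizes t [] _ = refl
nth-sizes (suc zero) (_ ∷ T) _ = refl
nth-sizes (suc (suc t)) (_ ∷ T) _ = nth-sizes (suc t) T (s≤s z≤n)

tower-pushOn : ∀ t c k (T : TowerTableau) → 1 ≤ t → 1 ≤ c →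
  tower c (pushOn t k T) ≡ tower c T ++ (if does (t ≟ c) then [ k ] else [])
tower-pushOn (suc zero) (suc zero) k [] _ _ = refl
tower-pushOn (suc zero) (suc (suc c)) k [] _ _ = refl
tower-pushOn (suc zero) (suc zero) k (_ ∷ T) _ _ = refl
tower-pushOn (suc zero) (suc (suc c)) k (_ ∷ T) _ _ = sym (++-identityʳ _)
tower-pushOn (suc (suc t)) (suc zero) k [] _ _ = refl
tower-pushOn (suc (suc t)) (suc (suc c)) k [] _ _ =
  tower-pushOn (suc t) (suc c) k [] (s≤s z≤n) (s≤s z≤n)
tower-pushOn (suc (suc t)) (suc zero) k (_ ∷ T) _ _ = sym (++-identityʳ _)
tower-pushOn (suc (suc t)) (suc (suc c)) k (_ ∷ T) _ _ =
  tower-pushOn (suc t) (suc c) k T (s≤s z≤n) (s≤s z≤n)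

buildTableau-∷ : ∀ k a as T t → slide a (sizes T) ≡ just t →
  buildTableau k (a ∷ as) T ≡ buildTableau (suc k) as (pushOn t k T)
buildTableau-∷ k a as T t slides with slide a (sizes T)
buildTableau-∷ k a as T t refl | just .t = refl

-- Building both tableaux side by side

record Invariant (n : ℕ) (w : List ℕ) (ss : List (ℕ × ℕ × ℕ)) (T : TowerTableau) : Set where
  field
    isPermutation : w ↭ oneTo n
    swapsAreInversions : ∀ {r u v} → (r , u , v) ∈ ss → v ∈ greaterBefore u w
    canonicalColumns : ∀ c → canonicalColumn ss w c ↭ columnSteps c ss
    towers : ∀ c → 1 ≤ c → tower c T ≡ columnSteps c ss

module _ {n} (P : List ℕ) {x y} (Q : List ℕ) (x<y : x < y) {ss T} (k : ℕ)
  (inv : Invariant n (P ++ x ∷ y ∷ Q) ss T) where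

  open Invariant inv

  private
    w = P ++ x ∷ y ∷ Q
    w′ = P ++ y ∷ x ∷ Q
    ss′ = ss ++ [ (k , x , y) ]

    n≡|w| : n ≡ length w
    n≡|w| = trans (sym (length-oneTo n)) (sym (↭-length isPermutation))

    module A = Ascent P x y Q x<y (subst (λ m → w ↭ oneTo m) n≡|w| isPermutation)

    heights : ∀ t → 1 ≤ t → nth t (sizes T) ≡ length (greaterBefore t w)
    heights t 1≤t = begin
      nth t (sizes T)                 ≡⟨ nth-sizes t T 1≤t ⟩
      length (tower t T)              ≡⟨ cong length (towers t 1≤t) ⟩
      length (columnSteps t ss)       ≡⟨ sym (↭-length (canonicalColumns t)) ⟩
      length (canonicalColumn ss w t) ≡⟨ length-map _ (greaterBefore t w) ⟩
      length (greaterBefore t w)      ∎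
      where open ≡-Reasoning

  slide-step : slide (suc (length P)) (sizes T) ≡ just x
  slide-step = A.slide-ascent (sizes T) heights

  private
    persists : ∀ u {v} → v ∈ greaterBefore u w → v ∈ greaterBefore u w′
    persists u v∈ with u ≟ x
    ... | yes refl = subst (_ ∈_) (sym A.greaterBefore′-x) (∈-++⁺ˡ v∈)
    ... | no u≢x = ∈-resp-↭ (↭-sym (A.greaterBefore′-≢x u u≢x)) v∈

    -- x stands before y in w, and inversions created by earlier steps persist: so no earlier step
    -- exchanged x and y, and no cell of D_w is labelled by a swap of x and y.
    newSwapElsewhere : ∀ c {v} → v ∈ greaterBefore c w → swapsValues v c (k , x , y) ≡ false
    newSwapElsewhere c v∈ = swapsValues-false _ c k x y
      (λ { (refl , refl) → <-asym x<y (All.lookup (greaterBefore-> y w) v∈) })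
      (λ { (refl , refl) → A.y∉greaterBefore-x v∈ })

    noEarlierSwapOfxy : ∀ {s} → s ∈ ss → swapsValues y x s ≡ false
    noEarlierSwapOfxy {r , u , v} s∈ = swapsValues-false y x r u v
      (λ { (refl , refl) → <-asym x<y (All.lookup (greaterBefore-> y w) (swapsAreInversions s∈)) })
      (λ { (refl , refl) → A.y∉greaterBefore-x (swapsAreInversions s∈) })

    oldLabels : ∀ c → map (λ v → stepSwapping ss′ v c) (greaterBefore c w) ≡ canonicalColumn ss w c
    oldLabels c =
      map-cong-local (All.tabulate (λ v∈ → stepSwapping-∷ʳ-other ss _ _ c (newSwapElsewhere c v∈)))

    canonicalColumns′ : ∀ c → canonicalColumn ss′ w′ c ↭ columnSteps c ss′
    canonicalColumns′ c with c ≟ x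
    ... | yes refl =
      subst₂ _↭_ (sym grown) (sym (columnSteps-∷ʳ-same ss k x y)) (++⁺ʳ [ k ] (canonicalColumns x))
      where
      grown : canonicalColumn ss′ w′ x ≡ canonicalColumn ss w x ++ [ k ]
      grown = begin
        map (λ v → stepSwapping ss′ v x) (greaterBefore x w′)
          ≡⟨ cong (map _) A.greaterBefore′-x ⟩
        map (λ v → stepSwapping ss′ v x) (greaterBefore x w ++ [ y ])
          ≡⟨ map-++ _ (greaterBefore x w) [ y ] ⟩
        map (λ v → stepSwapping ss′ v x) (greaterBefore x w) ++ [ stepSwapping ss′ y x ]
          ≡⟨ cong₂ _++_ (oldLabels x) (cong [_] newLabel) ⟩
        canonicalColumn ss w x ++ [ k ] ∎
        where
        open ≡-Reasoning
        newLabel : stepSwapping ss′ y x ≡ k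
        newLabel = stepSwapping-∷ʳ-first ss k x y y x noEarlierSwapOfxy (swapsValues-swapped k x y)
    ... | no c≢x = begin
      canonicalColumn ss′ w′ c                            ↭⟨ map⁺ _ (A.greaterBefore′-≢x c c≢x) ⟩
      map (λ v → stepSwapping ss′ v c) (greaterBefore c w) ≡⟨ oldLabels c ⟩
      canonicalColumn ss w c                              ↭⟨ canonicalColumns c ⟩
      columnSteps c ss                                    ≡⟨ sym (columnSteps-∷ʳ-other ss k x y c≢x) ⟩
      columnSteps c ss′                                   ∎
      where open PermutationReasoning

  invariant-step : Invariant n w′ ss′ (pushOn x k T)
  invariant-step = record
    { isPermutation = ↭-trans (↭-swap-middle P x y Q) isPermutation
    ; swapsAreInversions = λ s∈ → case ∈-++⁻ ss s∈ of λ
        { (inj₁ old) → persists _ (swapsAreInversions old)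
        ; (inj₂ (here refl)) →
            subst (y ∈_) (sym A.greaterBefore′-x) (∈-++⁺ʳ (greaterBefore x w) (here refl)) }
    ; canonicalColumns = canonicalColumns′
    ; towers = λ c 1≤c → begin
        tower c (pushOn x k T)                                   ≡⟨ tower-pushOn x c k T A.1≤x 1≤c ⟩
        tower c T ++ (if does (x ≟ c) then [ k ] else [])        ≡⟨ cong (_++ _) (towers c 1≤c) ⟩
        columnSteps c ss ++ (if does (x ≟ c) then [ k ] else []) ≡⟨ sym (columnSteps-∷ʳ c ss k x y) ⟩
        columnSteps c ss′                                        ∎
    }
    where open ≡-Reasoning

initial : ∀ n → Invariant n (oneTo n) [] []
initial n = record
  { isPermutation = ↭-refl
  ; swapsAreInversions = λ ()
  ; canonicalColumns = λ c → ↭-reflexive (cong (map _) (greaterBefore-from c 1 n))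
  ; towers = λ _ _ → refl
  }

build : ∀ {n} as k w ss T → Ascents w as → Invariant n w ss T →
  ∃ λ T′ → buildTableau k as T ≡ just T′ × Invariant n (applyWord w as) (ss ++ swaps k w as) T′
build [] k w ss T [] inv = T , refl , subst (λ ss′ → Invariant _ w ss′ T) (sym (++-identityʳ ss)) inv
build (_ ∷ as) k _ ss T (ascent P {x} {y} Q x<y ascents) inv
  with build as (suc k) _ _ (pushOn x k T) ascents (invariant-step P Q x<y k inv)
... | T′ , built , inv′ =
  T′ , trans (buildTableau-∷ k (suc (length P)) as T x (slide-step P Q x<y k inv)) built ,
  subst₂ (λ w ss′ → Invariant _ w ss′ T′) (sym (cong (λ w → applyWord w as) (swapAt-middle P x y Q)))
    (sym steps) inv′
  where
  open ≡-Reasoning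
  steps : ss ++ swaps k (P ++ x ∷ y ∷ Q) (suc (length P) ∷ as) ≡
          (ss ++ [ (k , x , y) ]) ++ swaps (suc k) (P ++ y ∷ x ∷ Q) as
  steps = begin
    ss ++ (k , nth (suc (length P)) (P ++ x ∷ y ∷ Q) , nth (suc (suc (length P))) (P ++ x ∷ y ∷ Q))
         ∷ swaps (suc k) (swapAt (suc (length P)) (P ++ x ∷ y ∷ Q)) as
      ≡⟨ cong (ss ++_) (cong₂ _∷_ (cong₂ (λ u v → (k , u , v)) (nth-middle P x y Q) (nth-middle′ P x y Q))
                                  (cong (λ w → swaps (suc k) w as) (swapAt-middle P x y Q))) ⟩
    ss ++ (k , x , y) ∷ swaps (suc k) (P ++ y ∷ x ∷ Q) as
      ≡⟨ sym (++-assoc ss [ (k , x , y) ] _) ⟩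
    (ss ++ [ (k , x , y) ]) ++ swaps (suc k) (P ++ y ∷ x ∷ Q) as ∎

mainTheorem6 : (ω α : List ℕ) → IsPermutation ω → IsReducedWord ω α →
  Σ TowerTableau (λ T → standardTowerTableau α ≡ just T ×
    ((c : ℕ) → 1 ≤ c →
      Linked _<_ (tower c T) × tower c T ↭ columnLabels ω α c))
mainTheorem6 ω α _ (inRange , word , reduced) with build α 1 (oneTo n) [] [] ascents (initial n)
  where
  n = length ω
  ascents : Ascents (oneTo n) α
  ascents = reduced⇒ascents n α (oneTo n) inRange (length-oneTo n)
    (trans (cong inversions word) (trans (sym reduced) (cong (_+ length α) (sym (inversions-from 1 n)))))
... | T , built , inv = T , built , λ c 1≤c → increasing c 1≤c , labels c 1≤c
  where
  open Invariant inv
  steps = swaps 1 (oneTo (length ω)) α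
  increasing : ∀ c → 1 ≤ c → Linked _<_ (tower c T)
  increasing c 1≤c =
    subst (Linked _<_) (sym (towers c 1≤c)) (AllPairs⇒Linked (proj₂ (columnSteps-swaps c 1 _ α)))
  labels : ∀ c → 1 ≤ c → tower c T ↭ columnLabels ω α c
  labels c 1≤c = begin
    tower c T                                                ≡⟨ towers c 1≤c ⟩
    columnSteps c steps                                      ↭⟨ ↭-sym (canonicalColumns c) ⟩
    canonicalColumn steps (applyWord (oneTo (length ω)) α) c ≡⟨ cong (λ w → canonicalColumn steps w c) word ⟩
    canonicalColumn steps ω c                                ≡⟨ sym (columnLabels-canonical ω α c) ⟩
    columnLabels ω α c                                       ∎
    where open PermutationReasoning
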